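{- Let $a>1$ be an integer with $t(a)=t(1)=1$. Then either $a=2$ (and the sequence is $(x_n^{(2)})$), or the sequence $(x_n^{(a)})$ essentially coincides with $(x_n^{(4)})$, i.e. there is $n_0$ such that $x_n^{(a)}=x_n^{(4)}$ for all $n\ge n_0$.
   Context: For a nonnegative integer $m$, $t(m)\in\{0,1\}$ is the parity of the number of ones in the binary expansion of $m$ (Thue–Morse sequence). For an integer $a>1$ with $t(a)=t(1)$, define $x_1^{(a)}=a$ and, for $n\ge2$, $x_n^{(a)}$ is the smallest integer $y>x_{n-1}^{(a)}$ with $t(y)=t(n)$. (E.g. $x^{(4)}$ begins $4,7,9,11,12,15,16,\dots$ and $x^{(2)}$ begins $2,4,5,7,9,\dots$.) -}

module Defs where

open import Data.Nat using (ℕ; zero; suc; _+_)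
open import Data.Nat.DivMod using (_/_; _%_)
open import Data.Bool using (Bool; true; false; _xor_; if_then_else_)
open import Data.Bool.Properties using () renaming (_≟_ to _≟ᵇ_)
open import Relation.Nullary using (yes; no)

-- Parity of the number of ones in the binary expansion of n,
-- computed with fuel n (n halves to 0 in at most n steps, so the fuel is ample).
-- true = 1, false = 0.
tAux : ℕ → ℕ → Bool
tAux zero    _ = false
tAux (suc f) n with n % 2
... | zero = tAux f (n / 2)
... | suc _ = true xor tAux f (n / 2)

t : ℕ → Bool
t n = tAux n n

searchFrom : ℕ → Bool → ℕ → ℕ
searchFrom zero    b z = z
searchFrom (suc f) b z with t z ≟ᵇ b
... | yes _ = z
... | no  _ = searchFrom f b (suc z)

-- Among any four consecutive integers there is an
-- aligned pair {2k, 2k+1} with t(2k) ≠ t(2k+1), so the search over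
-- z+1, ..., z+4 always succeeds and the fuel never runs out.
next : Bool → ℕ → ℕ
next b z = searchFrom 4 b (suc z)

-- x a n = x_n^{(a)} for n ≥ 1:  x_1 = a,  x_{n} = smallest y > x_{n-1} with t y = t n.
-- (The value at index 0 is a dummy and is never used in the statement's meaning.)
x : ℕ → ℕ → ℕ
x a zero = a
x a (suc zero) = a
x a (suc (suc n)) = next (t (suc (suc n))) (x a (suc n))

{-# OPTIONS --safe #-}

-- Since t(2m) = t(m) and t(2m+1) = not t(m), the two members of an aligned pair
-- {2m, 2m+1} have different t-values, so x_n is determined by the index m = n + d
-- of its pair; call d the offset.  Under the greedy rule the offset never
-- increases, and it can never fall from 1 to 0, so for a ≥ 4 it stays positive.
-- At an index N with t(N + d) = t(N) ≠ t(N + 1) a sequence of offset d is forced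
-- to sit at 2(N + d) and to move on to 2(N + d) + 1, which lowers its offset.
-- Such N exist beyond any bound for every d ≥ 2 (a new leading binary digit
-- complements t), so the offset eventually becomes 1, the offset of x^(4); two
-- sequences with the same offset coincide.
module Submission where

open import Defs
open import Data.Bool using (Bool; false; not; _xor_)
open import Data.Bool.Properties using (not-involutive; not-¬; ¬-not) renaming (_≟_ to _≟ᵇ_)
open import Data.Nat using (ℕ; zero; suc; _+_; _*_; _^_; _≤_; _<_; _≤′_; ≤′-refl; ≤′-step; z≤n; s≤s; s≤s⁻¹; _<ᵇ_)
open import Data.Nat.DivMod
open import Data.Nat.Induction using (<-rec)
open import Data.Nat.Properties
open import Data.Product using (∃; ∃-syntax; _×_; _,_)
open import Data.Sum using (_⊎_; inj₁; inj₂)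
open import Relation.Nullary using (yes; no; contradiction)
open import Relation.Binary.PropositionalEquality

isOdd : ℕ → Bool
isOdd n = 0 <ᵇ n % 2

tAux-suc : ∀ f n → tAux (suc f) n ≡ isOdd n xor tAux f (n / 2)
tAux-suc f n with n % 2
... | zero = refl
... | suc _ = refl

tAux-fuel-irrelevant : ∀ {f g} n → n ≤ f → n ≤ g → tAux f n ≡ tAux g n
tAux-fuel-irrelevant {f} {g} zero _ _ = trans (tAux-zero f) (sym (tAux-zero g))
  where
  tAux-zero : ∀ f → tAux f 0 ≡ false
  tAux-zero zero = refl
  tAux-zero (suc f) = tAux-zero f
tAux-fuel-irrelevant {suc f} {suc g} (suc n) (s≤s n≤f) (s≤s n≤g) = begin
  tAux (suc f) (suc n)                    ≡⟨ tAux-suc f (suc n) ⟩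
  isOdd (suc n) xor tAux f (suc n / 2)    ≡⟨ cong (isOdd (suc n) xor_) (tAux-fuel-irrelevant (suc n / 2) (≤-trans half≤n n≤f) (≤-trans half≤n n≤g)) ⟩
  isOdd (suc n) xor tAux g (suc n / 2)    ≡⟨ tAux-suc g (suc n) ⟨
  tAux (suc g) (suc n)                    ∎
  where
  open ≡-Reasoning
  half≤n : suc n / 2 ≤ n
  half≤n = s≤s⁻¹ (m/n<m (suc n) 2 (s≤s (s≤s z≤n)))

t-halve : ∀ n → t n ≡ isOdd n xor t (n / 2)
t-halve n = begin
  t n                            ≡⟨ tAux-fuel-irrelevant n ≤-refl (n≤1+n n) ⟩
  tAux (suc n) n                 ≡⟨ tAux-suc n n ⟩
  isOdd n xor tAux n (n / 2)     ≡⟨ cong (isOdd n xor_) (tAux-fuel-irrelevant (n / 2) (m/n≤m n 2) ≤-refl) ⟩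
  isOdd n xor t (n / 2)          ∎
  where open ≡-Reasoning

t-even : ∀ n → t (2 * n) ≡ t n
t-even n = trans (t-halve (2 * n)) (cong₂ (λ r h → (0 <ᵇ r) xor t h) rem quot)
  where
  rem : 2 * n % 2 ≡ 0
  rem = trans (cong (_% 2) (*-comm 2 n)) (m*n%n≡0 n 2)
  quot : 2 * n / 2 ≡ n
  quot = trans (cong (_/ 2) (*-comm 2 n)) (m*n/n≡m n 2)

t-odd : ∀ n → t (suc (2 * n)) ≡ not (t n)
t-odd n = trans (t-halve (suc (2 * n))) (cong₂ (λ r h → (0 <ᵇ r) xor t h) rem quot)
  where
  1+n*2≡1+2*n : 1 + n * 2 ≡ suc (2 * n)
  1+n*2≡1+2*n = cong suc (*-comm n 2)
  rem : suc (2 * n) % 2 ≡ 1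
  rem = trans (cong (_% 2) (sym 1+n*2≡1+2*n)) ([m+kn]%n≡m%n 1 n 2)
  quot : suc (2 * n) / 2 ≡ n
  quot = trans (cong (_/ 2) (sym 1+n*2≡1+2*n))
    (trans (+-distrib-/ 1 (n * 2) (subst (λ r → 1 + r < 2) (sym (m*n%n≡0 n 2)) ≤-refl)) (m*n/n≡m n 2))

data Parity : ℕ → Set where
  even : ∀ h → Parity (2 * h)
  odd  : ∀ h → Parity (suc (2 * h))

parity : ∀ n → Parity n
parity zero = even 0
parity (suc n) with parity n
... | even h = odd h
... | odd h = subst Parity (*-suc 2 h) (even (suc h))

t-leading-bit : ∀ k {n} → n < 2 ^ k → t (2 ^ k + n) ≡ not (t n)
t-leading-bit zero {zero} _ = refl
t-leading-bit zero {suc n} (s≤s ())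
t-leading-bit (suc k) {n} n<2^k+1 with parity n
... | even h = begin
  t (2 * 2 ^ k + 2 * h)   ≡⟨ cong t (*-distribˡ-+ 2 (2 ^ k) h) ⟨
  t (2 * (2 ^ k + h))     ≡⟨ t-even (2 ^ k + h) ⟩
  t (2 ^ k + h)           ≡⟨ t-leading-bit k (*-cancelˡ-< 2 h (2 ^ k) n<2^k+1) ⟩
  not (t h)               ≡⟨ cong not (t-even h) ⟨
  not (t (2 * h))         ∎
  where open ≡-Reasoning
... | odd h = begin
  t (2 * 2 ^ k + suc (2 * h))   ≡⟨ cong t (trans (+-suc (2 * 2 ^ k) (2 * h)) (cong suc (sym (*-distribˡ-+ 2 (2 ^ k) h)))) ⟩
  t (suc (2 * (2 ^ k + h)))     ≡⟨ t-odd (2 ^ k + h) ⟩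
  not (t (2 ^ k + h))           ≡⟨ cong not (t-leading-bit k (*-cancelˡ-< 2 h (2 ^ k) (<-trans (n<1+n _) n<2^k+1))) ⟩
  not (not (t h))               ≡⟨ cong not (t-odd h) ⟨
  not (t (suc (2 * h)))         ∎
  where open ≡-Reasoning

n<2^n : ∀ n → n < 2 ^ n
n<2^n zero = s≤s z≤n
n<2^n (suc n) = subst (_< 2 ^ suc n) (+-identityʳ (suc n))
  (+-mono-≤-< (n<2^n n) (subst (0 <_) (sym (+-identityʳ _)) (m^n>0 2 n)))

t-differs-at-distance : ∀ e → 0 < e → ∃[ w ] t (w + e) ≡ not (t w)
t-differs-at-distance = <-rec _ go
  where
  go : ∀ e → (∀ {e′} → e′ < e → 0 < e′ → ∃[ w ] t (w + e′) ≡ not (t w)) →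
       0 < e → ∃[ w ] t (w + e) ≡ not (t w)
  go e rec 0<e with parity e
  ... | odd h = 2 * h , trans (cong t 2h+[1+2h]≡1+2[2h]) (t-odd (2 * h))
    where
    2h+[1+2h]≡1+2[2h] : 2 * h + suc (2 * h) ≡ suc (2 * (2 * h))
    2h+[1+2h]≡1+2[2h] = trans (+-suc (2 * h) (2 * h)) (cong (λ m → suc (2 * h + m)) (sym (+-identityʳ (2 * h))))
  ... | even (suc h) with rec (m<m+n (suc h) (s≤s z≤n)) (s≤s z≤n)
  ...   | w , p = 2 * w , (begin
    t (2 * w + 2 * suc h)   ≡⟨ cong t (*-distribˡ-+ 2 w (suc h)) ⟨
    t (2 * (w + suc h))     ≡⟨ t-even (w + suc h) ⟩
    t (w + suc h)           ≡⟨ p ⟩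
    not (t w)               ≡⟨ cong not (t-even w) ⟨
    not (t (2 * w))         ∎)
    where open ≡-Reasoning

ForcesDrop : ℕ → ℕ → Set
ForcesDrop d N = t (N + d) ≡ t N × t (suc N) ≡ not (t N)

ForcesDrop-exists : ∀ {d} → 2 ≤ d → ∃[ v ] ForcesDrop d v
ForcesDrop-exists {d} 2≤d with parity d
... | even zero = contradiction 2≤d λ ()
... | odd zero = contradiction 2≤d λ { (s≤s ()) }
... | even (suc e) = d , trans (cong t (cong (d +_) (sym (+-identityʳ d)))) (t-even d) ,
                         trans (t-odd (suc e)) (cong not (sym (t-even (suc e))))
... | odd (suc e) with t-differs-at-distance (suc e) (s≤s z≤n)
...   | w , p = 2 * w , same , trans (t-odd w) (cong not (sym (t-even w)))
  where
  open ≡-Reasoning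
  same : t (2 * w + suc (2 * suc e)) ≡ t (2 * w)
  same = begin
    t (2 * w + suc (2 * suc e))   ≡⟨ cong t (trans (+-suc (2 * w) (2 * suc e)) (cong suc (sym (*-distribˡ-+ 2 w (suc e))))) ⟩
    t (suc (2 * (w + suc e)))     ≡⟨ t-odd (w + suc e) ⟩
    not (t (w + suc e))           ≡⟨ cong not p ⟩
    not (not (t w))               ≡⟨ not-involutive (t w) ⟩
    t w                           ≡⟨ t-even w ⟨
    t (2 * w)                     ∎

ForcesDrop-shift : ∀ k {d v} → suc (v + d) < 2 ^ k → ForcesDrop d v → ForcesDrop d (2 ^ k + v)
ForcesDrop-shift k {d} {v} lt (same , flip) = same′ , flip′
  where
  v+d<2^k : v + d < 2 ^ k
  v+d<2^k = <-trans (n<1+n (v + d)) lt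
  v<2^k : v < 2 ^ k
  v<2^k = ≤-<-trans (m≤m+n v d) v+d<2^k
  same′ : t (2 ^ k + v + d) ≡ t (2 ^ k + v)
  same′ = begin
    t (2 ^ k + v + d)     ≡⟨ cong t (+-assoc (2 ^ k) v d) ⟩
    t (2 ^ k + (v + d))   ≡⟨ t-leading-bit k v+d<2^k ⟩
    not (t (v + d))       ≡⟨ cong not same ⟩
    not (t v)             ≡⟨ t-leading-bit k v<2^k ⟨
    t (2 ^ k + v)         ∎
    where open ≡-Reasoning
  flip′ : t (suc (2 ^ k + v)) ≡ not (t (2 ^ k + v))
  flip′ = begin
    t (suc (2 ^ k + v))   ≡⟨ cong t (+-suc (2 ^ k) v) ⟨
    t (2 ^ k + suc v)     ≡⟨ t-leading-bit k (≤-<-trans (s≤s (m≤m+n v d)) lt) ⟩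
    not (t (suc v))       ≡⟨ cong not flip ⟩
    not (not (t v))       ≡⟨ cong not (t-leading-bit k v<2^k) ⟨
    not (t (2 ^ k + v))   ∎
    where open ≡-Reasoning

ForcesDrop-unbounded : ∀ {d} → 2 ≤ d → ∀ n → ∃[ N ] n ≤ N × ForcesDrop d N
ForcesDrop-unbounded {d} 2≤d n with ForcesDrop-exists 2≤d
... | v , forces = 2 ^ K + v , n≤N , ForcesDrop-shift K (≤-<-trans (m≤n+m _ n) (n<2^n K)) forces
  where
  K = n + suc (v + d)
  n≤N : n ≤ 2 ^ K + v
  n≤N = ≤-trans (≤-trans (m≤m+n n _) (<⇒≤ (n<2^n K))) (m≤m+n (2 ^ K) v)

InPair : ℕ → ℕ → Set
InPair m y = y ≡ 2 * m ⊎ y ≡ suc (2 * m)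

InPair-unique : ∀ {m y y′} → InPair m y → InPair m y′ → t y ≡ t y′ → y ≡ y′
InPair-unique (inj₁ y≡) (inj₁ y′≡) _ = trans y≡ (sym y′≡)
InPair-unique (inj₂ y≡) (inj₂ y′≡) _ = trans y≡ (sym y′≡)
InPair-unique {m} (inj₁ refl) (inj₂ refl) eq =
  contradiction (trans (sym (t-even m)) (trans eq (t-odd m))) (not-¬ refl)
InPair-unique {m} (inj₂ refl) (inj₁ refl) eq =
  contradiction (trans (sym (t-even m)) (trans (sym eq) (t-odd m))) (not-¬ refl)

searchFrom-here : ∀ f {b z} → t z ≡ b → searchFrom (suc f) b z ≡ z
searchFrom-here f {b} {z} tz≡b with t z ≟ᵇ b
... | yes _ = refl
... | no tz≢b = contradiction tz≡b tz≢b

searchFrom-skip : ∀ f {b z} → t z ≡ not b → searchFrom (suc f) b z ≡ searchFrom f b (suc z)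
searchFrom-skip f {b} {z} tz≡¬b with t z ≟ᵇ b
... | yes tz≡b = contradiction tz≡¬b (not-¬ tz≡b)
... | no _ = refl

searchFrom-pair : ∀ f b m → let y = searchFrom (2 + f) b (2 * m) in InPair m y × t y ≡ b
searchFrom-pair f b m with t (2 * m) ≟ᵇ b
... | yes t2m≡b = inj₁ refl , t2m≡b
... | no t2m≢b = subst (λ y → InPair m y × t y ≡ b) (sym (searchFrom-here f t1+2m≡b)) (inj₂ refl , t1+2m≡b)
  where
  t1+2m≡b : t (suc (2 * m)) ≡ b
  t1+2m≡b = begin
    t (suc (2 * m))    ≡⟨ t-odd m ⟩
    not (t m)          ≡⟨ cong not (trans (sym (t-even m)) (¬-not t2m≢b)) ⟩
    not (not b)        ≡⟨ not-involutive b ⟩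
    b                  ∎
    where open ≡-Reasoning

searchFrom-next-pair : ∀ f b m →
  let y = searchFrom (2 + f) b (suc (suc (2 * m))) in InPair (suc m) y × t y ≡ b
searchFrom-next-pair f b m =
  subst (λ z → let y = searchFrom (2 + f) b z in InPair (suc m) y × t y ≡ b) (*-suc 2 m) (searchFrom-pair f b (suc m))

record Offset (a n d : ℕ) : Set where
  constructor offset
  field
    in-pair : InPair (n + d) (x a n)
    t-agrees : t (x a n) ≡ t n

offset-of : ∀ {a n d y} → x a n ≡ y → InPair (n + d) y × t y ≡ t n → Offset a n d
offset-of refl (p , q) = offset p q

offset-drop : ∀ {a k e} → let m = suc k + suc (suc e) in
  x a (suc k) ≡ 2 * m → t (suc (2 * m)) ≡ t (2 + k) → Offset a (2 + k) (suc e)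
offset-drop {a} {k} {e} x≡2m hit =
  offset-of (trans (cong (next (t (2 + k))) x≡2m) (searchFrom-here 3 hit))
            (inj₂ (cong (λ j → suc (2 * j)) (+-suc (suc k) (suc e))) , hit)

offset-step : ∀ {a k d} → Offset a (suc k) (suc d) → ∃[ e ] e ≤ d × Offset a (2 + k) (suc e)
offset-step {a} {k} {d} (offset (inj₂ x≡) _) =
  d , ≤-refl , offset-of (cong (next (t (2 + k))) x≡) (searchFrom-next-pair 2 (t (2 + k)) (suc k + suc d))
offset-step {a} {k} {d} (offset (inj₁ x≡) _) with t (suc (2 * (suc k + suc d))) ≟ᵇ t (2 + k)
... | no miss = d , ≤-refl , offset-of
        (trans (cong (next (t (2 + k))) x≡) (searchFrom-skip 3 {z = suc (2 * (suc k + suc d))} (¬-not miss)))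
        (searchFrom-next-pair 1 (t (2 + k)) (suc k + suc d))
... | yes hit with d
...   | suc e = e , n≤1+n e , offset-drop x≡ hit
...   | zero = contradiction t[2+k]≡not-t[2+k] (not-¬ refl)
  where
  -- With offset 1 the pair of x_{k+1} has index k + 2 itself.
  t[2+k]≡not-t[2+k] : t (2 + k) ≡ not (t (2 + k))
  t[2+k]≡not-t[2+k] = begin
    t (2 + k)                        ≡⟨ hit ⟨
    t (suc (2 * (suc k + 1)))        ≡⟨ t-odd (suc k + 1) ⟩
    not (t (suc k + 1))              ≡⟨ cong (λ j → not (t j)) (+-comm (suc k) 1) ⟩
    not (t (2 + k))                  ∎
    where open ≡-Reasoning

forced-drop : ∀ {a k e} → ForcesDrop (2 + e) (suc k) → Offset a (suc k) (2 + e) → Offset a (2 + k) (suc e)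
forced-drop {a} {k} {e} (same , flip) (offset (inj₁ x≡) _) =
  offset-drop x≡ (trans (t-odd (suc k + (2 + e))) (trans (cong not same) (sym flip)))
forced-drop {a} {k} {e} (same , flip) (offset (inj₂ x≡) tx) = contradiction t[1+k]≡not-t[1+k] (not-¬ refl)
  where
  t[1+k]≡not-t[1+k] : t (suc k) ≡ not (t (suc k))
  t[1+k]≡not-t[1+k] = begin
    t (suc k)                        ≡⟨ tx ⟨
    t (x a (suc k))                  ≡⟨ cong t x≡ ⟩
    t (suc (2 * (suc k + (2 + e))))  ≡⟨ t-odd (suc k + (2 + e)) ⟩
    not (t (suc k + (2 + e)))        ≡⟨ cong not same ⟩
    not (t (suc k))                  ∎
    where open ≡-Reasoning

offset-nonincreasing : ∀ {a k m d} → k ≤ m → Offset a (suc k) (suc d) →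
  ∃[ e ] e ≤ d × Offset a (suc m) (suc e)
offset-nonincreasing {a} {k} {m} {d} k≤m o = walk (≤⇒≤′ k≤m)
  where
  walk : ∀ {m} → k ≤′ m → ∃[ e ] e ≤ d × Offset a (suc m) (suc e)
  walk ≤′-refl = d , ≤-refl , o
  walk (≤′-step k≤′m) with walk k≤′m
  ... | e , e≤d , o′ with offset-step o′
  ...   | e′ , e′≤e , o″ = e′ , ≤-trans e′≤e e≤d , o″

offset-decreases : ∀ {a k d} → Offset a (suc k) (2 + d) → ∃[ k′ ] ∃[ e ] e ≤ d × Offset a (suc k′) (suc e)
offset-decreases {a} {k} {d} o with ForcesDrop-unbounded {2 + d} (s≤s (s≤s z≤n)) (suc k)
... | zero , () , _
... | suc N , s≤s k≤N , forces with offset-nonincreasing k≤N o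
...   | e , e≤1+d , o′ with m≤n⇒m<n∨m≡n e≤1+d
...     | inj₁ e<1+d = N , e , s≤s⁻¹ e<1+d , o′
...     | inj₂ refl = suc N , d , ≤-refl , forced-drop forces o′

offset-reaches-one : ∀ d {a k e} → e ≤ d → Offset a (suc k) (suc e) → ∃[ k′ ] Offset a (suc k′) 1
offset-reaches-one _ z≤n o = _ , o
offset-reaches-one (suc d) (s≤s e≤d) o with offset-decreases o
... | k′ , e′ , e′≤e , o′ = offset-reaches-one d (≤-trans e′≤e e≤d) o′

offset-4 : Offset 4 1 1
offset-4 = offset (inj₁ refl) refl

offset-one⇒agrees-with-4 : ∀ {a k} → Offset a (suc k) 1 → ∀ n → suc k ≤ n → x a n ≡ x 4 n
offset-one⇒agrees-with-4 o (suc m) (s≤s k≤m)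
  with offset-nonincreasing {d = 0} k≤m o | offset-nonincreasing {m = m} {d = 0} z≤n offset-4
... | _ , z≤n , offset pair tx | _ , z≤n , offset pair₄ tx₄ = InPair-unique {suc m + 1} pair pair₄ (trans tx (sym tx₄))

initial-offset : ∀ c → t (4 + c) ≡ t 1 → ∃[ d ] Offset (4 + c) 1 (suc d)
initial-offset c ta with parity c
... | even h = h , offset (inj₁ (sym (*-distribˡ-+ 2 2 h))) ta
... | odd h = h , offset (inj₂ (cong suc (sym (*-distribˡ-+ 2 2 h)))) ta

theorem3 : (a : ℕ) → 1 < a → t a ≡ t 1 →
    a ≡ 2 ⊎ ∃ λ n₀ → (n : ℕ) → n₀ ≤ n → x a n ≡ x 4 n
theorem3 (suc zero) (s≤s ()) _
theorem3 (suc (suc zero)) _ _ = inj₁ refl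
theorem3 (suc (suc (suc zero))) _ ()
theorem3 (suc (suc (suc (suc c)))) _ ta with initial-offset c ta
... | d , o with offset-reaches-one d ≤-refl o
...   | k , o₁ = inj₂ (suc k , offset-one⇒agrees-with-4 o₁)
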